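{- In $\mathbf{MLM_{ext}}$, with $\mathrm{Acc}\,\gamma:=\mathrm{T}_{\mathbb{M}}(\mathrm{TI}^{\mathsf{tc}}\,g_{\mathrm{Acc}}\,\gamma)$: let $\alpha:\mathbb{V}$. Then $d=_{\mathrm{Acc}\,\alpha}e$ holds for any two terms $d,e$ of type $\mathrm{Acc}\,\alpha$.
   Context: $\mathbf{MLM_{ext}}$ is Martin-Löf type theory ($\Pi$ with $\eta$-rule, $\Sigma,+,\mathrm{N},\mathrm{N}_n,\mathrm{W}$) with Setzer's Mahlo universe $\mathbb{M}$ (decoding $\mathrm{T}_{\mathbb{M}}$, closed under codes including $\widehat{\Pi}_{\mathbb{M}},\widehat{\Sigma}_{\mathbb{M}},\widehat{+}_{\mathbb{M}}$ with $\mathrm{T}_{\mathbb{M}}(\widehat{\Pi}_{\mathbb{M}}(a,b))=\Pi_{(x:\mathrm{T}_{\mathbb{M}}a)}\mathrm{T}_{\mathbb{M}}(b\,x)$ etc.), but with extensional identity types: $\mathsf{r}:\mathrm{Id}(A,a,b)$ whenever $a=b:A$ judgementally, any $d:\mathrm{Id}(A,a,b)$ yields the judgement $a=b:A$, and $d=\mathsf{r}$. $\mathbb{V}:=\mathrm{W}_{(x:\mathbb{M})}\mathrm{T}_{\mathbb{M}}(x)$, $\mathsf{index}(\mathsf{sup}(a,f))=a$, $\mathsf{pred}(\mathsf{sup}(a,f))=f$, $\overline{\alpha}:=\mathrm{T}_{\mathbb{M}}(\mathsf{index}\,\alpha)$, $\forall\gamma\in\alpha\,G:=\Pi_{(x:\overline{\alpha})}G[\mathsf{pred}\,\alpha\,x/\gamma]$.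 $\bigcup\mathsf{sup}(a,f):=\mathsf{sup}(\widehat{\Sigma}_{\mathbb{M}}(a,\lambda x.\mathsf{index}(f\,x)),\lambda(x,y).\mathsf{pred}(f\,x)\,y)$, $\mathsf{sup}(a,f)\cup\mathsf{sup}(b,g):=\mathsf{sup}(a\,\widehat{+}_{\mathbb{M}}b,[f,g])$, $\mathsf{tc}(\mathsf{sup}(a,f)):=\mathsf{sup}(a,f)\cup\bigcup\mathsf{sup}(a,\lambda x.\mathsf{tc}(f\,x))$. For every type family $F$ over $\beta:\mathbb{V}$ there is a term $\mathrm{TI}^{\mathsf{tc}}:\Pi_{(\alpha:\mathbb{V})}(\forall\gamma\in\mathsf{tc}(\alpha)\,F[\gamma/\beta]\to F[\alpha/\beta])\to\Pi_{(\alpha:\mathbb{V})}F[\alpha/\beta]$ (transfinite induction along transitive closure) satisfying the judgemental computation rule $\mathrm{TI}^{\mathsf{tc}}\,g\,\alpha=g\,\alpha\,(\lambda x.\mathrm{TI}^{\mathsf{tc}}\,g\,(\mathsf{pred}\,\mathsf{tc}(\alpha)\,x)):F[\alpha/\beta]$. Taking $F:=\mathbb{M}$ and $g_{\mathrm{Acc}}:=\lambda\alpha.\lambda f.\widehat{\Pi}_{\mathbb{M}}(\mathsf{index}\,\mathsf{tc}(\alpha),\lambda x.f\,x):\Pi_{(\alpha:\mathbb{V})}(\forall\beta\in\mathsf{tc}(\alpha)\,\mathbb{M}\to\mathbb{M})$, one defines $\mathrm{Acc}\,\gamma:=\mathrm{T}_{\mathbb{M}}(\mathrm{TI}^{\mathsf{tc}}\,g_{\mathrm{Acc}}\,\gamma)$.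 -}

module Defs where

open import Level using (0ℓ)
open import Data.Product using (Σ; _,_; proj₁; proj₂)
open import Data.Sum using (_⊎_; inj₁; inj₂; [_,_])
open import Relation.Binary.PropositionalEquality using (_≡_; subst)
open import Axiom.Extensionality.Propositional using (Extensionality)

coe : {A B : Set} → A ≡ B → A → B
coe = subst (λ X → X)

-- The (relevant part of the) Mahlo universe 𝕄 with decoding T𝕄:
-- closed under Π̂, Σ̂, +̂, with the decoding equations.
-- (Judgemental decoding equations of MLM_ext are rendered as equalities
--  of types.)
record Universe : Set₁ where
  field
    𝕄   : Set
    T𝕄  : 𝕄 → Set
    Π̂   : (a : 𝕄) → (T𝕄 a → 𝕄) → 𝕄
    Σ̂   : (a : 𝕄) → (T𝕄 a → 𝕄) → 𝕄
    _+̂_ : 𝕄 → 𝕄 → 𝕄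
    T-Π̂ : (a : 𝕄) (b : T𝕄 a → 𝕄) → T𝕄 (Π̂ a b) ≡ ((x : T𝕄 a) → T𝕄 (b x))
    T-Σ̂ : (a : 𝕄) (b : T𝕄 a → 𝕄) → T𝕄 (Σ̂ a b) ≡ Σ (T𝕄 a) (λ x → T𝕄 (b x))
    T-+̂ : (a b : 𝕄) → T𝕄 (a +̂ b) ≡ (T𝕄 a ⊎ T𝕄 b)

data W (A : Set) (B : A → Set) : Set where
  sup : (a : A) → (B a → W A B) → W A B

module Sets (U : Universe) where
  open Universe U

  𝕍 : Set
  𝕍 = W 𝕄 T𝕄

  index : 𝕍 → 𝕄
  index (sup a f) = a

  pred : (α : 𝕍) → T𝕄 (index α) → 𝕍
  pred (sup a f) = f

  El : 𝕍 → Set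
  El α = T𝕄 (index α)

  ∀∈ : (α : 𝕍) → (𝕍 → Set) → Set
  ∀∈ α G = (x : El α) → G (pred α x)

  ⋃ : 𝕍 → 𝕍
  ⋃ (sup a f) =
    sup (Σ̂ a (λ x → index (f x)))
        (λ z → let p = coe (T-Σ̂ a (λ x → index (f x))) z
               in pred (f (proj₁ p)) (proj₂ p))

  _∪_ : 𝕍 → 𝕍 → 𝕍
  sup a f ∪ sup b g = sup (a +̂ b) (λ z → [ f , g ] (coe (T-+̂ a b) z))

  tc : 𝕍 → 𝕍
  tc (sup a f) = sup a f ∪ ⋃ (sup a (λ x → tc (f x)))

  -- Type of the step function for TI^tc with F := 𝕄 (constant family).
  TIStep : Set
  TIStep = (α : 𝕍) → ((x : El (tc α)) → 𝕄) → 𝕄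

  TIType : Set
  TIType = TIStep → 𝕍 → 𝕄

  TIComp : TIType → Set
  TIComp TI = (g : TIStep) (α : 𝕍) →
              TI g α ≡ g α (λ x → TI g (pred (tc α) x))

  g-Acc : TIStep
  g-Acc α f = Π̂ (index (tc α)) (λ x → f x)

  Acc : TIType → 𝕍 → Set
  Acc TI γ = T𝕄 (TI g-Acc γ)

-- Unfolding the computation rule of TI^tc, Acc α is the Π-type over the
-- elements γ of tc(α) of Acc γ.  By function extensionality a Π-type of
-- propositions is a proposition, so the claim follows by induction along
-- the transitive closure, which itself reduces to W-induction because every
-- element of tc(sup a f) is either some f i or an element of tc(f i).
module Submission where

open import Defs
open import Level using (0ℓ)
open import Data.Product using (proj₁; proj₂)
open import Data.Sum using (inj₁; inj₂)
open import Relation.Binary.PropositionalEquality using (_≡_; subst; cong; sym; trans)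
open import Relation.Nullary.Irrelevant using (Irrelevant)
open import Axiom.Extensionality.Propositional using (Extensionality)

Π-irrelevant : Extensionality 0ℓ 0ℓ → {A : Set} {B : A → Set} →
               (∀ x → Irrelevant (B x)) → Irrelevant ((x : A) → B x)
Π-irrelevant ext B-irr f g = ext (λ x → B-irr x (f x) (g x))

module TransitiveClosure (U : Universe) where
  open Universe U
  open Sets U

  ∀∈-tc-sup : (P : 𝕍 → Set) (a : 𝕄) (f : T𝕄 a → 𝕍) →
              (∀ i → P (f i)) → (∀ i → ∀∈ (tc (f i)) P) →
              ∀∈ (tc (sup a f)) P
  ∀∈-tc-sup P a f P-f P-tc-f z with coe (T-+̂ a _) z
  ... | inj₁ i = P-f i
  ... | inj₂ w = P-tc-f (proj₁ w′) (proj₂ w′)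
    where w′ = coe (T-Σ̂ a (λ i → index (tc (f i)))) w

  tc-ind : (P : 𝕍 → Set) → (∀ α → ∀∈ (tc α) P → P α) → ∀ α → P α
  tc-ind P step α = step α (below α)
    where
      below : ∀ α → ∀∈ (tc α) P
      below (sup a f) = ∀∈-tc-sup P a f (λ i → step (f i) (below (f i)))
                                        (λ i → below (f i))

module AccProperties (U : Universe) (TI : Sets.TIType U) (comp : Sets.TIComp U TI) where
  open Universe U
  open Sets U
  open TransitiveClosure U

  Acc-unfold : ∀ α → Acc TI α ≡ ((x : El (tc α)) → Acc TI (pred (tc α) x))
  Acc-unfold α = trans (cong T𝕄 (comp g-Acc α)) (T-Π̂ _ _)

  Acc-irrelevant : Extensionality 0ℓ 0ℓ → ∀ α → Irrelevant (Acc TI α)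
  Acc-irrelevant ext = tc-ind (λ γ → Irrelevant (Acc TI γ)) step
    where
      step : ∀ α → ∀∈ (tc α) (λ γ → Irrelevant (Acc TI γ)) → Irrelevant (Acc TI α)
      step α below = subst Irrelevant (sym (Acc-unfold α)) (Π-irrelevant ext below)

lemmaB3 : (U : Universe) → Extensionality 0ℓ 0ℓ →
          (TI : Sets.TIType U) → Sets.TIComp U TI →
          (α : Sets.𝕍 U) (d e : Sets.Acc U TI α) → d ≡ e
lemmaB3 U ext TI comp = AccProperties.Acc-irrelevant U TI comp ext
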